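{- Let $O=(0,0,0)$. The set of all equilateral triangles with vertices in $\mathbb{Z}^3$, one vertex equal to $O$ and the other two lying in the plane $\{(\alpha,\beta,\gamma):\alpha+\beta+5\gamma=0\}$ equals $$\{\,\{O,(4m-3n,\,m+3n,\,-m),\,(3m+n,\,-3m+4n,\,-n)\} : m,n\in\mathbb{Z},\ (m,n)\neq(0,0)\,\},$$ and the triangle corresponding to $(m,n)$ has side length $3\sqrt{2(m^2-mn+n^2)}$.
   Context: Triangles are regarded as unordered sets of three vertices. -}

module Defs where

open import Data.Integer using (ℤ; +_; _+_; _-_; _*_; -_)
open import Data.Product using (_×_; _,_; ∃-syntax)
open import Data.Sum using (_⊎_)
open import Relation.Binary.PropositionalEquality using (_≡_)
open import Relation.Nullary using (¬_)
open import Function.Bundles using (_⇔_)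

Point : Set
Point = ℤ × ℤ × ℤ

O : Point
O = (+ 0 , + 0 , + 0)

dist² : Point → Point → ℤ
dist² (a₁ , a₂ , a₃) (b₁ , b₂ , b₃) =
  (a₁ - b₁) * (a₁ - b₁) + (a₂ - b₂) * (a₂ - b₂) + (a₃ - b₃) * (a₃ - b₃)

InPlane : Point → Set
InPlane (a , b , c) = a + b + (+ 5) * c ≡ + 0

-- a triangle is an unordered set of three vertices; {P,Q,R} as a membership predicate
_∈Tri_ : Point → Point × Point × Point → Set
X ∈Tri (P , Q , R) = (X ≡ P) ⊎ (X ≡ Q) ⊎ (X ≡ R)

SameTri : Point × Point × Point → Point × Point × Point → Set
SameTri T T' = ∀ X → (X ∈Tri T) ⇔ (X ∈Tri T')

Equilateral : Point → Point → Point → Set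
Equilateral P Q R =
  ¬ (P ≡ Q) × ¬ (Q ≡ R) × ¬ (P ≡ R) ×
  (dist² P Q ≡ dist² Q R) × (dist² Q R ≡ dist² P R)

vA : ℤ → ℤ → Point
vA m n = ((+ 4) * m - (+ 3) * n , m + (+ 3) * n , - m)

vB : ℤ → ℤ → Point
vB m n = ((+ 3) * m + n , - ((+ 3) * m) + (+ 4) * n , - n)

NonZeroPair : ℤ → ℤ → Set
NonZeroPair m n = ¬ ((m , n) ≡ (+ 0 , + 0))

{-# OPTIONS --safe #-}
-- Lattice points of the plane α + β + 5γ = 0 are the points (-b - 5c, b, c), and squared distances
-- between them are twice the positive definite form N(x, y) = x² + 5xy + 13y² of discriminant -27
-- at coordinate differences. If O, P = (b, c), Q = (e, f) is equilateral with N-value k, then the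
-- polar form of N at P, Q is k as well, and Lagrange's identity 4 N(P) N(Q) = polar² + 27 w²,
-- w = bf - ce, leaves k = ∓3w. Up to swapping P and Q we have k = -3w, and then 3Q - 3ρP has
-- N-value 27 (k + 3w) / 2 = 0 for the rotation ρ by 60°, so Q = ρP. Since 3ρ is integral, Q is a
-- lattice point exactly when 3 divides b + c, which gives the parametrisation
-- (b, c) = (m + 3n, -m), (e, f) = (-3m + 4n, -n). Conversely all three sides of these triangles
-- are 18 (m² - mn + n²), which vanishes only at m = n = 0 since 4 (m² - mn + n²) = (2m - n)² + 3n².
module Submission where

open import Defs
open import Data.Integer using (ℤ; +_; _+_; _-_; _*_)
open import Data.Product using (_×_; _,_; ∃-syntax)
open import Relation.Binary.PropositionalEquality using (_≡_)
open import Function.Bundles using (_⇔_)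

open import Data.Integer using (-_; 0ℤ; ∣_∣; -[1+_]; +[1+_])
open import Data.Integer.Properties
  using (+◃n≡+n; pos-+; pos-*; +-injective; +-identityˡ; +-identityʳ; neg-involutive;
         neg-distribʳ-*; i*j≡0⇒i≡0∨j≡0; *-cancelˡ-≡; i≡j⇒i-j≡0)
open import Data.Integer.Solver using (module +-*-Solver)
import Data.Nat as ℕ
import Data.Nat.Properties as ℕ
open import Data.Empty using (⊥-elim)
open import Data.Product using (proj₁; proj₂; uncurry)
open import Data.Sum using (_⊎_; inj₁; inj₂; reduce)
import Data.Sum as Sum
open import Function using (_∘_; id)
open import Function.Bundles using (mk⇔; Equivalence)
open import Relation.Binary.PropositionalEquality
  using (_≢_; refl; sym; trans; cong; cong₂; subst; subst₂; module ≡-Reasoning)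

open +-*-Solver using (Polynomial; con; _:+_; _:*_; _:-_; :-_; _:=_; solve)
open ≡-Reasoning

i*i≡+∣i∣*∣i∣ : ∀ i → i * i ≡ + (∣ i ∣ ℕ.* ∣ i ∣)
i*i≡+∣i∣*∣i∣ (+ n)    = +◃n≡+n (n ℕ.* n)
i*i≡+∣i∣*∣i∣ -[1+ n ] = +◃n≡+n (ℕ.suc n ℕ.* ℕ.suc n)

i*i≡0⇒i≡0 : ∀ i → i * i ≡ 0ℤ → i ≡ 0ℤ
i*i≡0⇒i≡0 i = reduce ∘ i*j≡0⇒i≡0∨j≡0 i

i*i+[1+k]*j*j≡0⇒i≡0×j≡0 : ∀ k i j → i * i + +[1+ k ] * (j * j) ≡ 0ℤ → i ≡ 0ℤ × j ≡ 0ℤ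
i*i+[1+k]*j*j≡0⇒i≡0×j≡0 k i j eq = square≡0 i I≡0 , square≡0 j J≡0
  where
  I J : ℕ.ℕ
  I = ∣ i ∣ ℕ.* ∣ i ∣
  J = ∣ j ∣ ℕ.* ∣ j ∣

  sum≡0 : I ℕ.+ ℕ.suc k ℕ.* J ≡ 0
  sum≡0 = +-injective (begin
    + (I ℕ.+ ℕ.suc k ℕ.* J)      ≡⟨ pos-+ I _ ⟩
    + I + + (ℕ.suc k ℕ.* J)      ≡⟨ cong (λ x → + I + x) (pos-* (ℕ.suc k) J) ⟩
    + I + +[1+ k ] * + J         ≡⟨ sym (cong₂ (λ x y → x + +[1+ k ] * y) (i*i≡+∣i∣*∣i∣ i) (i*i≡+∣i∣*∣i∣ j)) ⟩
    i * i + +[1+ k ] * (j * j)   ≡⟨ eq ⟩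
    0ℤ                           ∎)

  I≡0 : I ≡ 0
  I≡0 = ℕ.m+n≡0⇒m≡0 I sum≡0

  J≡0 : J ≡ 0
  J≡0 with ℕ.m*n≡0⇒m≡0∨n≡0 (ℕ.suc k) (ℕ.m+n≡0⇒n≡0 I sum≡0)
  ... | inj₂ J≡0 = J≡0

  square≡0 : ∀ x → ∣ x ∣ ℕ.* ∣ x ∣ ≡ 0 → x ≡ 0ℤ
  square≡0 x eq = i*i≡0⇒i≡0 x (trans (i*i≡+∣i∣*∣i∣ x) (cong +_ eq))

planePoint : ℤ → ℤ → Point
planePoint b c = (- b - + 5 * c , b , c)

form : ℤ → ℤ → ℤ
form x y = x * x + + 5 * (x * y) + + 13 * (y * y)

polar : ℤ → ℤ → ℤ → ℤ → ℤ
polar b c e f = + 2 * (b * e) + + 5 * (b * f + c * e) + + 26 * (c * f)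

wedge : ℤ → ℤ → ℤ → ℤ → ℤ
wedge b c e f = b * f - c * e

private
  module _ {arity : ℕ.ℕ} where
    Pointₚ : Set
    Pointₚ = Polynomial arity × Polynomial arity × Polynomial arity

    dist²ₚ : Pointₚ → Pointₚ → Polynomial arity
    dist²ₚ (a₁ , a₂ , a₃) (b₁ , b₂ , b₃) =
      (a₁ :- b₁) :* (a₁ :- b₁) :+ (a₂ :- b₂) :* (a₂ :- b₂) :+ (a₃ :- b₃) :* (a₃ :- b₃)

    planePointₚ : Polynomial arity → Polynomial arity → Pointₚ
    planePointₚ b c = (:- b :- con (+ 5) :* c , b , c)

    formₚ : Polynomial arity → Polynomial arity → Polynomial arity
    formₚ x y = x :* x :+ con (+ 5) :* (x :* y) :+ con (+ 13) :* (y :* y)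

    Oₚ : Pointₚ
    Oₚ = (con 0ℤ , con 0ℤ , con 0ℤ)

    vAₚ vBₚ : Polynomial arity → Polynomial arity → Pointₚ
    vAₚ m n = (con (+ 4) :* m :- con (+ 3) :* n , m :+ con (+ 3) :* n , :- m)
    vBₚ m n = (con (+ 3) :* m :+ n , :- (con (+ 3) :* m) :+ con (+ 4) :* n , :- n)

    polarₚ wedgeₚ : Polynomial arity → Polynomial arity → Polynomial arity → Polynomial arity → Polynomial arity
    polarₚ b c e f = con (+ 2) :* (b :* e) :+ con (+ 5) :* (b :* f :+ c :* e) :+ con (+ 26) :* (c :* f)
    wedgeₚ b c e f = b :* f :- c :* e

dist²-sym : ∀ P Q → dist² P Q ≡ dist² Q P
dist²-sym (a₁ , a₂ , a₃) (b₁ , b₂ , b₃) =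
  solve 6 (λ a₁ a₂ a₃ b₁ b₂ b₃ → dist²ₚ (a₁ , a₂ , a₃) (b₁ , b₂ , b₃) := dist²ₚ (b₁ , b₂ , b₃) (a₁ , a₂ , a₃))
    refl a₁ a₂ a₃ b₁ b₂ b₃

dist²-self : ∀ P → dist² P P ≡ 0ℤ
dist²-self (a₁ , a₂ , a₃) =
  solve 3 (λ a₁ a₂ a₃ → dist²ₚ (a₁ , a₂ , a₃) (a₁ , a₂ , a₃) := con 0ℤ) refl a₁ a₂ a₃

dist²≢0⇒≢ : ∀ {P Q} → dist² P Q ≢ 0ℤ → P ≢ Q
dist²≢0⇒≢ {P} dist²≢0 refl = dist²≢0 (dist²-self P)

Equilateral-swap : ∀ {R P Q} → Equilateral R P Q → Equilateral R Q P
Equilateral-swap {P = P} {Q} (R≢P , P≢Q , R≢Q , RP≡PQ , PQ≡RQ) =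
  R≢Q , P≢Q ∘ sym , R≢P , trans (sym PQ≡RQ) (dist²-sym P Q) , trans (dist²-sym Q P) (sym RP≡PQ)

SameTri-≡ : ∀ {R P Q A B} → P ≡ A → Q ≡ B → SameTri (R , P , Q) (R , A , B)
SameTri-≡ refl refl X = mk⇔ id id

SameTri-swap : ∀ {R P Q A B} → P ≡ B → Q ≡ A → SameTri (R , P , Q) (R , A , B)
SameTri-swap {R} refl refl X = mk⇔ swap swap
  where
  swap : ∀ {P Q} → X ∈Tri (R , P , Q) → X ∈Tri (R , Q , P)
  swap (inj₁ X≡R)         = inj₁ X≡R
  swap (inj₂ (inj₁ X≡P)) = inj₂ (inj₂ X≡P)
  swap (inj₂ (inj₂ X≡Q)) = inj₂ (inj₁ X≡Q)

SameTri⇒≡⊎swapped : ∀ {R P Q A B} → R ≢ A → A ≢ B → R ≢ B → SameTri (R , P , Q) (R , A , B) →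
  (P ≡ A × Q ≡ B) ⊎ (P ≡ B × Q ≡ A)
SameTri⇒≡⊎swapped {A = A} {B} R≢A A≢B R≢B same
  with Equivalence.from (same A) (inj₂ (inj₁ refl)) | Equivalence.from (same B) (inj₂ (inj₂ refl))
... | inj₁ A≡R         | _                  = ⊥-elim (R≢A (sym A≡R))
... | _                | inj₁ B≡R           = ⊥-elim (R≢B (sym B≡R))
... | inj₂ (inj₁ A≡P) | inj₂ (inj₁ B≡P)   = ⊥-elim (A≢B (trans A≡P (sym B≡P)))
... | inj₂ (inj₂ A≡Q) | inj₂ (inj₂ B≡Q)   = ⊥-elim (A≢B (trans A≡Q (sym B≡Q)))
... | inj₂ (inj₁ A≡P) | inj₂ (inj₂ B≡Q)   = inj₁ (sym A≡P , sym B≡Q)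
... | inj₂ (inj₂ A≡Q) | inj₂ (inj₁ B≡P)   = inj₂ (sym B≡P , sym A≡Q)

inPlane⇒≡planePoint : ∀ {a b c} → InPlane (a , b , c) → (a , b , c) ≡ planePoint b c
inPlane⇒≡planePoint {a} {b} {c} inPlane = cong (_, b , c) (begin
  a                                  ≡⟨ solve 3 (λ a b c → a := (a :+ b :+ con (+ 5) :* c) :+ (:- b :- con (+ 5) :* c)) refl a b c ⟩
  (a + b + + 5 * c) + (- b - + 5 * c) ≡⟨ cong (_+ (- b - + 5 * c)) inPlane ⟩
  0ℤ + (- b - + 5 * c)               ≡⟨ +-identityˡ _ ⟩
  - b - + 5 * c                      ∎)

planePoint-inPlane : ∀ b c → InPlane (planePoint b c)
planePoint-inPlane b c = solve 2 (λ b c → (:- b :- con (+ 5) :* c) :+ b :+ con (+ 5) :* c := con 0ℤ) refl b c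

dist²-planePoint : ∀ b c e f → dist² (planePoint b c) (planePoint e f) ≡ + 2 * form (b - e) (c - f)
dist²-planePoint = solve 4 (λ b c e f →
  dist²ₚ (planePointₚ b c) (planePointₚ e f) := con (+ 2) :* formₚ (b :- e) (c :- f)) refl

dist²-O-planePoint : ∀ b c → dist² O (planePoint b c) ≡ + 2 * form b c
dist²-O-planePoint = solve 2 (λ b c →
  dist²ₚ Oₚ (planePointₚ b c) := con (+ 2) :* formₚ b c) refl

form-polar : ∀ b c e f → polar b c e f ≡ form b c + form e f - form (b - e) (c - f)
form-polar = solve 4 (λ b c e f →
  polarₚ b c e f := formₚ b c :+ formₚ e f :- formₚ (b :- e) (c :- f)) refl

form-lagrange : ∀ b c e f →
  + 4 * (form b c * form e f) ≡ polar b c e f * polar b c e f + + 27 * (wedge b c e f * wedge b c e f)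
form-lagrange = solve 4 (λ b c e f →
  con (+ 4) :* (formₚ b c :* formₚ e f) := polarₚ b c e f :* polarₚ b c e f :+ con (+ 27) :* (wedgeₚ b c e f :* wedgeₚ b c e f)) refl

-- (3e - 4b - 13c, 3f + b + c) = 3 (Q - ρP), where ρ = [[4, 13], [-1, -1]] / 3 is the rotation by 60°
-- of the plane in the coordinates (b, c) (indeed ρ² - ρ + 1 = 0).
form-turn : ∀ b c e f →
  + 2 * form (+ 3 * e - + 4 * b - + 13 * c) (+ 3 * f + b + c)
    ≡ + 9 * (form b c + form e f + form (b - e) (c - f)) + + 81 * wedge b c e f
form-turn = solve 4 (λ b c e f →
  con (+ 2) :* formₚ (con (+ 3) :* e :- con (+ 4) :* b :- con (+ 13) :* c) (con (+ 3) :* f :+ b :+ c)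
    := con (+ 9) :* (formₚ b c :+ formₚ e f :+ formₚ (b :- e) (c :- f)) :+ con (+ 81) :* wedgeₚ b c e f) refl

form-sub-comm : ∀ b c e f → form (e - b) (f - c) ≡ form (b - e) (c - f)
form-sub-comm = solve 4 (λ b c e f → formₚ (e :- b) (f :- c) := formₚ (b :- e) (c :- f)) refl

wedge-antisym : ∀ b c e f → wedge e f b c ≡ - wedge b c e f
wedge-antisym = solve 4 (λ b c e f → wedgeₚ e f b c := :- wedgeₚ b c e f) refl

form-completed-square : ∀ x y →
  + 4 * form x y ≡ (+ 2 * x + + 5 * y) * (+ 2 * x + + 5 * y) + + 27 * (y * y)
form-completed-square = solve 2 (λ x y →
  con (+ 4) :* formₚ x y := (con (+ 2) :* x :+ con (+ 5) :* y) :* (con (+ 2) :* x :+ con (+ 5) :* y) :+ con (+ 27) :* (y :* y)) refl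

form≡0⇒x≡0×y≡0 : ∀ x y → form x y ≡ 0ℤ → x ≡ 0ℤ × y ≡ 0ℤ
form≡0⇒x≡0×y≡0 x y form≡0 = x≡0 , y≡0
  where
  squares≡0 : + 2 * x + + 5 * y ≡ 0ℤ × y ≡ 0ℤ
  squares≡0 = i*i+[1+k]*j*j≡0⇒i≡0×j≡0 26 (+ 2 * x + + 5 * y) y
    (trans (sym (form-completed-square x y)) (cong (+ 4 *_) form≡0))

  y≡0 : y ≡ 0ℤ
  y≡0 = proj₂ squares≡0

  x≡0 : x ≡ 0ℤ
  x≡0 = *-cancelˡ-≡ (+ 2) x 0ℤ (begin
    + 2 * x                ≡⟨ +-identityʳ _ ⟨
    + 2 * x + + 5 * 0ℤ     ≡⟨ cong (λ y → + 2 * x + + 5 * y) y≡0 ⟨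
    + 2 * x + + 5 * y      ≡⟨ proj₁ squares≡0 ⟩
    0ℤ                     ∎)

4k²≡k²+27w²⇒k≡∓3w : ∀ k w → + 4 * (k * k) ≡ k * k + + 27 * (w * w) → k + + 3 * w ≡ 0ℤ ⊎ k - + 3 * w ≡ 0ℤ
4k²≡k²+27w²⇒k≡∓3w k w eq = i*j≡0⇒i≡0∨j≡0 (k + + 3 * w) (*-cancelˡ-≡ (+ 3) _ 0ℤ (begin
  + 3 * ((k + + 3 * w) * (k - + 3 * w))        ≡⟨ solve 2 (λ k w →
                                                    con (+ 3) :* ((k :+ con (+ 3) :* w) :* (k :- con (+ 3) :* w))
                                                      := con (+ 4) :* (k :* k) :- (k :* k :+ con (+ 27) :* (w :* w))) refl k w ⟩
  + 4 * (k * k) - (k * k + + 27 * (w * w))     ≡⟨ i≡j⇒i-j≡0 eq ⟩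
  0ℤ                                           ∎))

module _ {k : ℤ} (b c e f : ℤ) (P≡k : form b c ≡ k) (Q≡k : form e f ≡ k) (PQ≡k : form (b - e) (c - f) ≡ k) where

  equilateral⇒polar≡k : polar b c e f ≡ k
  equilateral⇒polar≡k = begin
    polar b c e f                               ≡⟨ form-polar b c e f ⟩
    form b c + form e f - form (b - e) (c - f) ≡⟨ cong₂ _-_ (cong₂ _+_ P≡k Q≡k) PQ≡k ⟩
    k + k - k                                   ≡⟨ solve 1 (λ k → k :+ k :- k := k) refl k ⟩
    k                                           ∎

  equilateral⇒k≡∓3w : k + + 3 * wedge b c e f ≡ 0ℤ ⊎ k - + 3 * wedge b c e f ≡ 0ℤ
  equilateral⇒k≡∓3w = 4k²≡k²+27w²⇒k≡∓3w k w (begin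
    + 4 * (k * k)                       ≡⟨ cong (λ x → + 4 * x) (sym (cong₂ _*_ P≡k Q≡k)) ⟩
    + 4 * (form b c * form e f)         ≡⟨ form-lagrange b c e f ⟩
    polar b c e f * polar b c e f + + 27 * (w * w) ≡⟨ cong (λ D → D * D + + 27 * (w * w)) equilateral⇒polar≡k ⟩
    k * k + + 27 * (w * w)              ∎)
    where
    w : ℤ
    w = wedge b c e f

  equilateral⇒turn≡0 : k + + 3 * wedge b c e f ≡ 0ℤ →
    + 3 * e - + 4 * b - + 13 * c ≡ 0ℤ × + 3 * f + b + c ≡ 0ℤ
  equilateral⇒turn≡0 k+3w≡0 = form≡0⇒x≡0×y≡0 _ _ (*-cancelˡ-≡ (+ 2) _ 0ℤ (begin
    + 2 * form (+ 3 * e - + 4 * b - + 13 * c) (+ 3 * f + b + c) ≡⟨ form-turn b c e f ⟩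
    + 9 * (form b c + form e f + form (b - e) (c - f)) + + 81 * w
                                                    ≡⟨ cong (λ s → + 9 * s + + 81 * w) (cong₂ _+_ (cong₂ _+_ P≡k Q≡k) PQ≡k) ⟩
    + 9 * (k + k + k) + + 81 * w                   ≡⟨ solve 2 (λ k w →
                                                        con (+ 9) :* (k :+ k :+ k) :+ con (+ 81) :* w
                                                          := con (+ 27) :* (k :+ con (+ 3) :* w)) refl k w ⟩
    + 27 * (k + + 3 * w)                           ≡⟨ cong (+ 27 *_) k+3w≡0 ⟩
    0ℤ                                             ∎))
    where
    w : ℤ
    w = wedge b c e f

vA≡planePoint : ∀ m n → vA m n ≡ planePoint (m + + 3 * n) (- m)
vA≡planePoint m n = cong (_, m + + 3 * n , - m)
  (solve 2 (λ m n → con (+ 4) :* m :- con (+ 3) :* n := :- (m :+ con (+ 3) :* n) :- con (+ 5) :* (:- m)) refl m n)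

vB≡planePoint : ∀ m n → vB m n ≡ planePoint (- (+ 3 * m) + + 4 * n) (- n)
vB≡planePoint m n = cong (_, - (+ 3 * m) + + 4 * n , - n)
  (solve 2 (λ m n → con (+ 3) :* m :+ n := :- (:- (con (+ 3) :* m) :+ con (+ 4) :* n) :- con (+ 5) :* (:- n)) refl m n)

turn≡0⇒vA-vB : ∀ b c e f → + 3 * e - + 4 * b - + 13 * c ≡ 0ℤ × + 3 * f + b + c ≡ 0ℤ →
  planePoint b c ≡ vA (- c) (- f) × planePoint e f ≡ vB (- c) (- f)
turn≡0⇒vA-vB b c e f (turn₁≡0 , turn₂≡0) =
  trans (cong₂ planePoint b≡ (sym (neg-involutive c))) (sym (vA≡planePoint (- c) (- f))) ,
  trans (cong₂ planePoint e≡ (sym (neg-involutive f))) (sym (vB≡planePoint (- c) (- f)))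
  where
  b≡ : b ≡ - c + + 3 * - f
  b≡ = begin
    b                                          ≡⟨ solve 3 (λ b c f →
                                                    b := (con (+ 3) :* f :+ b :+ c) :+ (:- c :+ con (+ 3) :* (:- f))) refl b c f ⟩
    (+ 3 * f + b + c) + (- c + + 3 * - f)      ≡⟨ cong (_+ (- c + + 3 * - f)) turn₂≡0 ⟩
    0ℤ + (- c + + 3 * - f)                     ≡⟨ +-identityˡ _ ⟩
    - c + + 3 * - f                            ∎

  e≡ : e ≡ - (+ 3 * - c) + + 4 * - f
  e≡ = *-cancelˡ-≡ (+ 3) _ _ (begin
    + 3 * e                                            ≡⟨ solve 3 (λ b c e →
                                                            con (+ 3) :* e := (con (+ 3) :* e :- con (+ 4) :* b :- con (+ 13) :* c)
                                                                               :+ (con (+ 4) :* b :+ con (+ 13) :* c)) refl b c e ⟩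
    (+ 3 * e - + 4 * b - + 13 * c) + (+ 4 * b + + 13 * c) ≡⟨ cong (_+ (+ 4 * b + + 13 * c)) turn₁≡0 ⟩
    0ℤ + (+ 4 * b + + 13 * c)                           ≡⟨ +-identityˡ _ ⟩
    + 4 * b + + 13 * c                                  ≡⟨ cong (λ b → + 4 * b + + 13 * c) b≡ ⟩
    + 4 * (- c + + 3 * - f) + + 13 * c                  ≡⟨ solve 2 (λ c f →
                                                            con (+ 4) :* (:- c :+ con (+ 3) :* (:- f)) :+ con (+ 13) :* c
                                                              := con (+ 3) :* (:- (con (+ 3) :* (:- c)) :+ con (+ 4) :* (:- f))) refl c f ⟩
    + 3 * (- (+ 3 * - c) + + 4 * - f)                   ∎)

equilateral⇒vA-vB : ∀ {k} b c e f → form b c ≡ k → form e f ≡ k → form (b - e) (c - f) ≡ k →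
  (planePoint b c ≡ vA (- c) (- f) × planePoint e f ≡ vB (- c) (- f)) ⊎
  (planePoint e f ≡ vA (- f) (- c) × planePoint b c ≡ vB (- f) (- c))
equilateral⇒vA-vB {k} b c e f P≡k Q≡k PQ≡k =
  Sum.map (turn≡0⇒vA-vB b c e f ∘ equilateral⇒turn≡0 b c e f P≡k Q≡k PQ≡k)
          (turn≡0⇒vA-vB e f b c ∘ equilateral⇒turn≡0 e f b c Q≡k P≡k QP≡k ∘ k-3w≡0⇒k+3w′≡0)
          (equilateral⇒k≡∓3w b c e f P≡k Q≡k PQ≡k)
  where
  QP≡k : form (e - b) (f - c) ≡ k
  QP≡k = trans (form-sub-comm b c e f) PQ≡k

  w : ℤ
  w = wedge b c e f

  k-3w≡0⇒k+3w′≡0 : k - + 3 * w ≡ 0ℤ → k + + 3 * wedge e f b c ≡ 0ℤ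
  k-3w≡0⇒k+3w′≡0 k-3w≡0 = begin
    k + + 3 * wedge e f b c   ≡⟨ cong (λ w′ → k + + 3 * w′) (wedge-antisym b c e f) ⟩
    k + + 3 * - w             ≡⟨ cong (_+_ k) (neg-distribʳ-* (+ 3) w) ⟨
    k - + 3 * w               ≡⟨ k-3w≡0 ⟩
    0ℤ                        ∎

m*m-m*n+n*n≡0⇒m≡0×n≡0 : ∀ m n → m * m - m * n + n * n ≡ 0ℤ → m ≡ 0ℤ × n ≡ 0ℤ
m*m-m*n+n*n≡0⇒m≡0×n≡0 m n q≡0 = m≡0 , n≡0
  where
  squares≡0 : + 2 * m - n ≡ 0ℤ × n ≡ 0ℤ
  squares≡0 = i*i+[1+k]*j*j≡0⇒i≡0×j≡0 2 (+ 2 * m - n) n (begin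
    (+ 2 * m - n) * (+ 2 * m - n) + + 3 * (n * n) ≡⟨ solve 2 (λ m n →
        (con (+ 2) :* m :- n) :* (con (+ 2) :* m :- n) :+ con (+ 3) :* (n :* n)
          := con (+ 4) :* (m :* m :- m :* n :+ n :* n)) refl m n ⟩
    + 4 * (m * m - m * n + n * n)                ≡⟨ cong (+ 4 *_) q≡0 ⟩
    0ℤ                                           ∎)

  n≡0 : n ≡ 0ℤ
  n≡0 = proj₂ squares≡0

  m≡0 : m ≡ 0ℤ
  m≡0 = *-cancelˡ-≡ (+ 2) m 0ℤ (begin
    + 2 * m         ≡⟨ +-identityʳ _ ⟨
    + 2 * m - 0ℤ    ≡⟨ cong (λ n → + 2 * m - n) n≡0 ⟨
    + 2 * m - n     ≡⟨ proj₁ squares≡0 ⟩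
    0ℤ              ∎)

dist²-O-vA : ∀ m n → dist² O (vA m n) ≡ + 18 * (m * m - m * n + n * n)
dist²-O-vA = solve 2 (λ m n → dist²ₚ Oₚ (vAₚ m n) := con (+ 18) :* (m :* m :- m :* n :+ n :* n)) refl

dist²-O-vB : ∀ m n → dist² O (vB m n) ≡ + 18 * (m * m - m * n + n * n)
dist²-O-vB = solve 2 (λ m n → dist²ₚ Oₚ (vBₚ m n) := con (+ 18) :* (m :* m :- m :* n :+ n :* n)) refl

dist²-vA-vB : ∀ m n → dist² (vA m n) (vB m n) ≡ + 18 * (m * m - m * n + n * n)
dist²-vA-vB = solve 2 (λ m n → dist²ₚ (vAₚ m n) (vBₚ m n) := con (+ 18) :* (m :* m :- m :* n :+ n :* n)) refl

vA-inPlane : ∀ m n → InPlane (vA m n)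
vA-inPlane m n = subst InPlane (sym (vA≡planePoint m n)) (planePoint-inPlane (m + + 3 * n) (- m))

vB-inPlane : ∀ m n → InPlane (vB m n)
vB-inPlane m n = subst InPlane (sym (vB≡planePoint m n)) (planePoint-inPlane (- (+ 3 * m) + + 4 * n) (- n))

equilateral-vA-vB : ∀ {m n} → NonZeroPair m n → Equilateral O (vA m n) (vB m n)
equilateral-vA-vB {m} {n} nonZero =
  distinct (dist²-O-vA m n) , distinct (dist²-vA-vB m n) , distinct (dist²-O-vB m n) ,
  trans (dist²-O-vA m n) (sym (dist²-vA-vB m n)) , trans (dist²-vA-vB m n) (sym (dist²-O-vB m n))
  where
  side² : ℤ
  side² = + 18 * (m * m - m * n + n * n)

  side²≢0 : side² ≢ 0ℤ
  side²≢0 = nonZero ∘ uncurry (cong₂ _,_) ∘ m*m-m*n+n*n≡0⇒m≡0×n≡0 m n ∘ *-cancelˡ-≡ (+ 18) _ 0ℤ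

  distinct : ∀ {X Y} → dist² X Y ≡ side² → X ≢ Y
  distinct X-Y≡side = dist²≢0⇒≢ (side²≢0 ∘ trans (sym X-Y≡side))

Parametrised : Point → Point → Set
Parametrised P Q = ∃[ m ] ∃[ n ] (NonZeroPair m n × SameTri (O , P , Q) (O , vA m n , vB m n))

O≢⇒NonZeroPair : ∀ {P m n} (v : ℤ → ℤ → Point) → v 0ℤ 0ℤ ≡ O → P ≡ v m n → O ≢ P → NonZeroPair m n
O≢⇒NonZeroPair v v₀≡O refl O≢P refl = O≢P (sym v₀≡O)

planePoints-equilateral⇒Parametrised : ∀ b c e f → Equilateral O (planePoint b c) (planePoint e f) →
  Parametrised (planePoint b c) (planePoint e f)
planePoints-equilateral⇒Parametrised b c e f (O≢P , _ , _ , OP≡PQ , PQ≡OQ) =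
  Sum.[ (λ (P≡A , Q≡B) → - c , - f , O≢⇒NonZeroPair vA refl P≡A O≢P , SameTri-≡ P≡A Q≡B)
      , (λ (Q≡A , P≡B) → - f , - c , O≢⇒NonZeroPair vB refl P≡B O≢P , SameTri-swap P≡B Q≡A)
      ]′ (equilateral⇒vA-vB b c e f refl Q≡P PQ≡P)
  where
  halve : ∀ {x y} → + 2 * x ≡ + 2 * y → x ≡ y
  halve = *-cancelˡ-≡ (+ 2) _ _

  PQ≡P : form (b - e) (c - f) ≡ form b c
  PQ≡P = halve (begin
    + 2 * form (b - e) (c - f)               ≡⟨ dist²-planePoint b c e f ⟨
    dist² (planePoint b c) (planePoint e f)  ≡⟨ OP≡PQ ⟨
    dist² O (planePoint b c)                 ≡⟨ dist²-O-planePoint b c ⟩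
    + 2 * form b c                           ∎)

  Q≡P : form e f ≡ form b c
  Q≡P = halve (begin
    + 2 * form e f                           ≡⟨ dist²-O-planePoint e f ⟨
    dist² O (planePoint e f)                 ≡⟨ PQ≡OQ ⟨
    dist² (planePoint b c) (planePoint e f)  ≡⟨ OP≡PQ ⟨
    dist² O (planePoint b c)                 ≡⟨ dist²-O-planePoint b c ⟩
    + 2 * form b c                           ∎)

equilateral⇒Parametrised : ∀ P Q → Equilateral O P Q × InPlane P × InPlane Q → Parametrised P Q
equilateral⇒Parametrised (_ , b , c) (_ , e , f) (equilateral , inP , inQ) =
  subst₂ (λ P Q → Equilateral O P Q → Parametrised P Q)
    (sym (inPlane⇒≡planePoint inP)) (sym (inPlane⇒≡planePoint inQ))
    (planePoints-equilateral⇒Parametrised b c e f) equilateral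

vA-vB-equilateral-inPlane : ∀ {P Q m n} → NonZeroPair m n →
  (P ≡ vA m n × Q ≡ vB m n) ⊎ (P ≡ vB m n × Q ≡ vA m n) → Equilateral O P Q × InPlane P × InPlane Q
vA-vB-equilateral-inPlane {m = m} {n} nonZero (inj₁ (refl , refl)) =
  equilateral-vA-vB nonZero , vA-inPlane m n , vB-inPlane m n
vA-vB-equilateral-inPlane {m = m} {n} nonZero (inj₂ (refl , refl)) =
  Equilateral-swap (equilateral-vA-vB nonZero) , vB-inPlane m n , vA-inPlane m n

Parametrised⇒equilateral : ∀ {P Q} → Parametrised P Q → Equilateral O P Q × InPlane P × InPlane Q
Parametrised⇒equilateral (m , n , nonZero , same) =
  let O≢A , A≢B , O≢B , _ = equilateral-vA-vB nonZero
  in vA-vB-equilateral-inPlane nonZero (SameTri⇒≡⊎swapped O≢A A≢B O≢B same)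

mainTheorem8 :
    ((P Q : Point) →
      (Equilateral O P Q × InPlane P × InPlane Q)
        ⇔ (∃[ m ] ∃[ n ] (NonZeroPair m n × SameTri (O , P , Q) (O , vA m n , vB m n))))
    ×
    ((m n : ℤ) → NonZeroPair m n →
      (dist² O (vA m n) ≡ (+ 18) * (m * m - m * n + n * n))
      × (dist² O (vB m n) ≡ (+ 18) * (m * m - m * n + n * n))
      × (dist² (vA m n) (vB m n) ≡ (+ 18) * (m * m - m * n + n * n)))
mainTheorem8 =
  (λ P Q → mk⇔ (equilateral⇒Parametrised P Q) Parametrised⇒equilateral) ,
  (λ m n _ → dist²-O-vA m n , dist²-O-vB m n , dist²-vA-vB m n)
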